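{- Let $G=(V,E)$ be a dually chordal graph containing no clique of size four, and let $T=(V,E_t)$ be a spanning tree of $G$ such that for every edge $uv \in E$, every vertex $w \in P_T(u,v)$ satisfies $uw \in E$ and $vw \in E$. Let $\mathcal{C}$ be an induced chordless cycle $C_k$ in $G$ with $k \ge 4$. Then there is a vertex $w$ not on $\mathcal{C}$ that is adjacent to every vertex of $\mathcal{C}$ (so $\mathcal{C}$ and $w$ form a wheel $W_k$), and no edge of $\mathcal{C}$ is an edge of $T$.
   Context: All graphs are finite, undirected, connected, without loops or multiple edges. A graph is dually chordal if it has a maximum neighbourhood ordering, i.e. an ordering $(v_1,\ldots,v_n)$ of its vertices such that each $v_i$ has a vertex $u$ in $G_i := G[\{v_i,\ldots,v_n\}]$, adjacent or equal to $v_i$, with $N_{G_i}[w] \subseteq N_{G_i}[u]$ for all $w \in N_{G_i}[v_i]$. For a tree $T$, $P_T(u,v)$ is the set of vertices on the $T$-path from $u$ to $v$, excluding $u$ and $v$. A chordless cycle $C_k$ has vertices $c_1,\ldots,c_k$ and exactly the edges $c_ic_{i+1}$ (indices mod $k$). A wheel $W_k$ is a $C_k$ plus one further vertex adjacent to all vertices of the $C_k$. -}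

module Defs where

open import Data.Nat using (ℕ; zero; suc; _≤_)
open import Data.Fin using (Fin; toℕ)
open import Data.Bool using (Bool; true)
open import Data.List using (List; []; _∷_)
open import Data.List.Membership.Propositional using (_∈_)
open import Data.List.Relation.Unary.Unique.Propositional using (Unique)
open import Data.Product using (Σ; _×_; ∃; ∃-syntax)
open import Data.Sum using (_⊎_)
open import Data.Empty using (⊥)
open import Relation.Nullary using (¬_)
open import Relation.Binary.PropositionalEquality using (_≡_; _≢_)
open import Function.Definitions using (Injective)

record Graph (n : ℕ) : Set where
  field
    adj    : Fin n → Fin n → Bool
    sym    : ∀ u v → adj u v ≡ true → adj v u ≡ true
    irrefl : ∀ u → ¬ (adj u u ≡ true)

module _ {n : ℕ} where

  E : Graph n → Fin n → Fin n → Set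
  E G u v = Graph.adj G u v ≡ true

  data Walk (G : Graph n) : Fin n → Fin n → Set where
    nil  : ∀ u → Walk G u u
    cons : ∀ {u v w} → E G u v → Walk G v w → Walk G u w

  verts : ∀ {G u v} → Walk G u v → List (Fin n)
  verts (nil u)            = u ∷ []
  verts (cons {u = u} _ p) = u ∷ verts p

  nverts : ∀ {G u v} → Walk G u v → ℕ
  nverts (nil u)    = 1
  nverts (cons _ p) = suc (nverts p)

  IsPath : ∀ {G u v} → Walk G u v → Set
  IsPath p = Unique (verts p)

  Connected : Graph n → Set
  Connected G = ∀ u v → Walk G u v

  Acyclic : Graph n → Set
  Acyclic G = ∀ u v (p : Walk G v u) → IsPath p → 3 ≤ nverts p → ¬ E G u v

  SpanningTree : Graph n → Graph n → Set
  SpanningTree G T = (∀ u v → E T u v → E G u v) × Connected T × Acyclic T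

  -- w ∈ P_T(u,v): w is an inner vertex of the (unique) T-path from u to v
  InTreePath : Graph n → Fin n → Fin n → Fin n → Set
  InTreePath T u v w =
    w ≢ u × w ≢ v × Σ (Walk T u v) (λ p → IsPath p × w ∈ verts p)

  -- closed neighbourhood of w in G_i = G[{v_i,...,v_n}] for ordering ord (v_i = ord i)
  InSuffix : (Fin n → Fin n) → Fin n → Fin n → Set
  InSuffix ord i x = ∃[ j ] (toℕ i ≤ toℕ j × ord j ≡ x)

  NbhdSuffix : Graph n → (Fin n → Fin n) → Fin n → Fin n → Fin n → Set
  NbhdSuffix G ord i w x = InSuffix ord i x × (x ≡ w ⊎ E G w x)

  MaxNeighbourhoodOrdering : Graph n → (Fin n → Fin n) → Set
  MaxNeighbourhoodOrdering G ord =
    Injective _≡_ _≡_ ord ×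
    (∀ i → ∃[ u ] (NbhdSuffix G ord i (ord i) u ×
        (∀ w → NbhdSuffix G ord i (ord i) w →
          ∀ x → NbhdSuffix G ord i w x → NbhdSuffix G ord i u x)))

  DuallyChordal : Graph n → Set
  DuallyChordal G = ∃[ ord ] MaxNeighbourhoodOrdering G ord

  K4Free : Graph n → Set
  K4Free G = ∀ a b c d → E G a b → E G a c → E G a d → E G b c → E G b d → E G c d → ⊥

Consec : (k : ℕ) → Fin k → Fin k → Set
Consec k i j = (suc (toℕ i) ≡ toℕ j) ⊎ (suc (toℕ i) ≡ k × toℕ j ≡ 0)

CycAdj : (k : ℕ) → Fin k → Fin k → Set
CycAdj k i j = Consec k i j ⊎ Consec k j i

InducedCycle : ∀ {n} → Graph n → (k : ℕ) → (Fin k → Fin n) → Set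
InducedCycle G k c =
  Injective _≡_ _≡_ c × (∀ i j → (E G (c i) (c j) → CycAdj k i j) × (CycAdj k i j → E G (c i) (c j)))

-- For a G-edge uv, the inner vertices of the T-path from u to v are common neighbours of u and
-- v and pairwise adjacent, so in a K4-free G there is at most one of them. Now let p, u, v be
-- consecutive on the cycle. Moving the start of a T-path with a fixed end from v back to p the
-- long way round the cycle, one edge at a time, never brings u onto it: u would have to lie
-- inside the T-path between the two ends of that cycle edge, hence be adjacent to both, but its
-- only cycle neighbours are p and v. So a T-edge uv would put v inside P_T(p, u) and force the
-- chord pv; otherwise the T-neighbour w of u towards v lies inside P_T(p, u) as well. Hence the
-- single inner vertices of P_T along consecutive cycle edges coincide: that vertex is the hub.

module Submission where

open import Defs
open import Data.Nat using (ℕ; zero; suc; _≤_; _<_; _+_; _*_; _%_; _/_; z≤n; s≤s; NonZero)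
open import Data.Nat.Properties
  using (+-suc; *-suc; +-assoc; m≤n⇒m<n∨m≡n; ≤-refl; ≤-trans; n≤1+n; m≤n⇒m≤1+n; m<n⇒m<1+n; <⇒≢; 0≢1+n; 1+n≢0)
open import Data.Nat.DivMod
  using (%-distribˡ-+; %-remove-+ˡ; m≡m%n+[m/n]*n; [m+kn]%n≡m%n; m%n<n; m<n⇒m%n≡m; n%n≡0)
open import Data.Nat.Divisibility using (∣-refl)
open import Data.Fin using (Fin; toℕ; fromℕ<; _≟_)
open import Data.Fin.Properties using (toℕ-injective; toℕ-fromℕ<; toℕ<n)
open import Data.List using (List; []; _∷_; _++_)
open import Data.List.Membership.Propositional using (_∈_; _∉_)
open import Data.List.Membership.Propositional.Properties using (∈-++⁺ˡ; ∈-++⁺ʳ; ∈-++⁻)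
open import Data.List.Relation.Binary.Subset.Propositional using (_⊆_)
open import Data.List.Relation.Unary.Any using (here; there)
open import Data.List.Relation.Unary.All using ([])
open import Data.List.Relation.Unary.All.Properties using (All¬⇒¬Any; ¬Any⇒All¬)
open import Data.List.Relation.Unary.Unique.Propositional using (Unique; []; _∷_)
open import Data.List.Relation.Unary.Unique.Propositional.Properties using (++⁺; Unique[x∷xs]⇒x∉xs)
open import Data.Product using (_×_; ∃-syntax; _,_; proj₁; proj₂)
open import Data.Sum using (_⊎_; inj₁; inj₂)
open import Data.Empty using (⊥-elim)
open import Relation.Nullary using (¬_; yes; no)
open import Relation.Nullary.Decidable using (decidable-stable)
open import Relation.Binary.PropositionalEquality
  using (_≡_; _≢_; refl; sym; trans; cong; subst; subst₂; ≢-sym; module ≡-Reasoning)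
open import Function using (_∘_; id)
open import Function.Definitions using (Injective)

open ≡-Reasoning

module WalkProperties {n : ℕ} (G : Graph n) where

  open import Data.List.Membership.DecPropositional (_≟_ {n}) using (_∈?_)

  private variable u v w x : Fin n

  snoc : Walk G u v → E G v w → Walk G u w
  snoc (nil _)     e = cons e (nil _)
  snoc (cons e′ p) e = cons e′ (snoc p e)

  reverse : Walk G u v → Walk G v u
  reverse (nil u)    = nil u
  reverse (cons e p) = snoc (reverse p) (Graph.sym G _ _ e)

  _++ʷ_ : Walk G u v → Walk G v w → Walk G u w
  nil _    ++ʷ q = q
  cons e p ++ʷ q = cons e (p ++ʷ q)

  verts-snoc : (p : Walk G u v) (e : E G v w) → verts (snoc p e) ≡ verts p ++ w ∷ []
  verts-snoc (nil _)              e = refl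
  verts-snoc (cons {u = u} e′ p) e = cong (u ∷_) (verts-snoc p e)

  head∈verts : (p : Walk G u v) → u ∈ verts p
  head∈verts (nil _)    = here refl
  head∈verts (cons _ _) = here refl

  last∈verts : (p : Walk G u v) → v ∈ verts p
  last∈verts (nil _)    = here refl
  last∈verts (cons _ p) = there (last∈verts p)

  ∈-++ʷ⁻ : (p : Walk G u v) (q : Walk G v w) → x ∈ verts (p ++ʷ q) → x ∈ verts p ⊎ x ∈ verts q
  ∈-++ʷ⁻ (nil _)    q x∈q           = inj₂ x∈q
  ∈-++ʷ⁻ (cons _ p) q (here x≡u)   = inj₁ (here x≡u)
  ∈-++ʷ⁻ (cons _ p) q (there x∈pq) with ∈-++ʷ⁻ p q x∈pq
  ... | inj₁ x∈p = inj₁ (there x∈p)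
  ... | inj₂ x∈q = inj₂ x∈q

  ∈-reverse⁻ : (p : Walk G u v) → x ∈ verts (reverse p) → x ∈ verts p
  ∈-reverse⁻ (nil _)    x∈p = x∈p
  ∈-reverse⁻ (cons e p) x∈p
    with ∈-++⁻ (verts (reverse p)) (subst (_ ∈_) (verts-snoc (reverse p) _) x∈p)
  ... | inj₁ x∈rp       = there (∈-reverse⁻ p x∈rp)
  ... | inj₂ (here x≡u) = here x≡u

  ∈-reverse⁺ : (p : Walk G u v) → x ∈ verts p → x ∈ verts (reverse p)
  ∈-reverse⁺ (nil _)    x∈p = x∈p
  ∈-reverse⁺ (cons e p) x∈p = subst (_ ∈_) (sym (verts-snoc (reverse p) _)) (split x∈p)
    where
    split : x ∈ verts (cons e p) → x ∈ verts (reverse p) ++ _ ∷ []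
    split (here x≡u)  = ∈-++⁺ʳ (verts (reverse p)) (here x≡u)
    split (there x∈p) = ∈-++⁺ˡ (∈-reverse⁺ p x∈p)

  snoc-isPath : (p : Walk G u v) (e : E G v w) → IsPath p → w ∉ verts p → IsPath (snoc p e)
  snoc-isPath p e p-path w∉p = subst Unique (sym (verts-snoc p e))
    (++⁺ p-path ([] ∷ []) λ { (w∈p , here refl) → w∉p w∈p })

  reverse-isPath : (p : Walk G u v) → IsPath p → IsPath (reverse p)
  reverse-isPath (nil u)    _             = [] ∷ []
  reverse-isPath (cons e p) (u∉p ∷ p-path) =
    snoc-isPath (reverse p) _ (reverse-isPath p p-path) (All¬⇒¬Any u∉p ∘ ∈-reverse⁻ p)

  2≤nverts : u ≢ v → (p : Walk G u v) → 2 ≤ nverts p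
  2≤nverts u≢u (nil _)             = ⊥-elim (u≢u refl)
  2≤nverts _   (cons _ (nil _))    = s≤s (s≤s z≤n)
  2≤nverts _   (cons _ (cons _ _)) = s≤s (s≤s z≤n)

  record PathWithin (xs : List (Fin n)) (u v : Fin n) : Set where
    field
      walk   : Walk G u v
      isPath : IsPath walk
      within : verts walk ⊆ xs

  suffix : (p : Walk G u v) → IsPath p → x ∈ verts p → PathWithin (verts p) x v
  suffix (nil _)    p-path (here refl) = record { walk = nil _ ; isPath = p-path ; within = id }
  suffix (cons e p) p-path (here refl) = record { walk = cons e p ; isPath = p-path ; within = id }
  suffix (cons e p) (_ ∷ p-path) (there x∈p) =
    record { PathWithin r ; within = there ∘ PathWithin.within r }
    where r = suffix p p-path x∈p

  toPath : (p : Walk G u v) → PathWithin (verts p) u v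
  toPath (nil u) = record { walk = nil u ; isPath = [] ∷ [] ; within = id }
  toPath (cons {u = u} e p) with toPath p
  ... | record { walk = q ; isPath = q-path ; within = q⊆p } with u ∈? verts q
  ...   | yes u∈q = let r = suffix q q-path u∈q in
                    record { PathWithin r ; within = there ∘ q⊆p ∘ PathWithin.within r }
  ...   | no u∉q  = record { walk = cons e q ; isPath = ¬Any⇒All¬ _ u∉q ∷ q-path
                           ; within = λ { (here y≡u) → here y≡u ; (there y∈q) → there (q⊆p y∈q) } }

module TreeProperties {n : ℕ} (T : Graph n) (connected : Connected T) (acyclic : Acyclic T) where

  open WalkProperties T

  private variable u v w x : Fin n

  isPath-unique : (p q : Walk T u v) → IsPath p → IsPath q → verts p ≡ verts q
  isPath-unique (nil _) (nil _)    _ _             = refl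
  isPath-unique (nil _) (cons _ q) _ (u∉q ∷ _)     = ⊥-elim (All¬⇒¬Any u∉q (last∈verts q))
  isPath-unique (cons _ p) (nil _) (u∉p ∷ _) _     = ⊥-elim (All¬⇒¬Any u∉p (last∈verts p))
  isPath-unique (cons {u = u} {v = x} e₁ p) (cons {v = y} e₂ q) (u∉p ∷ p-path) (u∉q ∷ q-path)
    with x ≟ y
  ... | yes refl = cong (u ∷_) (isPath-unique p q p-path q-path)
  ... | no x≢y   = ⊥-elim (acyclic x u (cons e₂ walk) (¬Any⇒All¬ _ u∉r ∷ isPath)
                                    (s≤s (2≤nverts (≢-sym x≢y) walk)) (Graph.sym T _ _ e₁))
    where
    open PathWithin (toPath (q ++ʷ reverse p))
    u∉r : u ∉ verts walk
    u∉r u∈r with ∈-++ʷ⁻ q (reverse p) (within u∈r)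
    ... | inj₁ u∈q  = All¬⇒¬Any u∉q u∈q
    ... | inj₂ u∈rp = All¬⇒¬Any u∉p (∈-reverse⁻ p u∈rp)

  pathWalk : ∀ u v → Walk T u v
  pathWalk u v = PathWithin.walk (toPath (connected u v))

  pathWalk-isPath : ∀ u v → IsPath (pathWalk u v)
  pathWalk-isPath u v = PathWithin.isPath (toPath (connected u v))

  path : Fin n → Fin n → List (Fin n)
  path u v = verts (pathWalk u v)

  path-unique : (p : Walk T u v) → IsPath p → verts p ≡ path u v
  path-unique p p-path = isPath-unique p (pathWalk _ _) p-path (pathWalk-isPath _ _)

  head∈path : ∀ u v → u ∈ path u v
  head∈path u v = head∈verts (pathWalk u v)

  path-refl : ∀ v → path v v ≡ v ∷ []
  path-refl v = sym (path-unique (nil v) ([] ∷ []))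

  path-sym : path v u ⊆ path u v
  path-sym {v} {u} x∈ = subst (_ ∈_) (path-unique _ (reverse-isPath _ (pathWalk-isPath v u)))
                          (∈-reverse⁺ (pathWalk v u) x∈)

  path-median : ∀ v → x ∈ path u w → x ∈ path u v ⊎ x ∈ path v w
  path-median {u = u} {w = w} v x∈ = ∈-++ʷ⁻ (pathWalk u v) (pathWalk v w)
    (within (subst (_ ∈_) (sym (path-unique walk isPath)) x∈))
    where open PathWithin (toPath (pathWalk u v ++ʷ pathWalk v w))

  path-snoc : E T w v → v ∉ path u w → w ∈ path u v
  path-snoc {w = w} {u = u} e v∉ =
    subst (_ ∈_) (path-unique (snoc p e) (snoc-isPath p e (pathWalk-isPath u w) v∉))
      (subst (_ ∈_) (sym (verts-snoc p e)) (∈-++⁺ˡ (last∈verts p)))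
    where p = pathWalk u w

  path-successor : u ≢ v → ∃[ w ] (E T u w × path u v ≡ u ∷ path w v)
  path-successor {u} {v} u≢v = successor (pathWalk u v) (pathWalk-isPath u v)
    where
    successor : (p : Walk T u v) → IsPath p → ∃[ w ] (E T u w × verts p ≡ u ∷ path w v)
    successor (nil _)    _            = ⊥-elim (u≢v refl)
    successor (cons e p) (_ ∷ p-path) = _ , e , cong (u ∷_) (path-unique p p-path)

  inTreePath⁺ : w ≢ u → w ≢ v → w ∈ path u v → InTreePath T u v w
  inTreePath⁺ {u = u} {v = v} w≢u w≢v w∈ = w≢u , w≢v , pathWalk u v , pathWalk-isPath u v , w∈

  inTreePath⁻ : InTreePath T u v w → w ∈ path u v
  inTreePath⁻ (_ , _ , p , p-path , w∈p) = subst (_ ∈_) (path-unique p p-path) w∈p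

InnerVerticesAdjacent : ∀ {n} → Graph n → Graph n → Set
InnerVerticesAdjacent G T = ∀ u v → E G u v → ∀ w → InTreePath T u v w → E G u w × E G v w

module TreePathsOfEdges {n : ℕ} (G T : Graph n) (connected : Connected T) (acyclic : Acyclic T)
  (inner-adjacent : InnerVerticesAdjacent G T) where

  open TreeProperties T connected acyclic

  private variable u v x y : Fin n

  path-avoid-step : x ∉ path u y → E G u v → x ≢ u → x ≢ v → ¬ (E G u x × E G v x) → x ∉ path v y
  path-avoid-step {u = u} {v = v} x∉ e x≢u x≢v not-both x∈ with path-median u x∈
  ... | inj₁ x∈vu = not-both (inner-adjacent u v e _ (inTreePath⁺ x≢u x≢v (path-sym x∈vu)))
  ... | inj₂ x∈uy = x∉ x∈uy

  inTreePath-unique : K4Free G → E G u v → InTreePath T u v x → InTreePath T u v y → x ≡ y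
  inTreePath-unique {u} {v} {x} {y} k4 e x-inner@(x≢u , x≢v , _) y-inner@(y≢u , y≢v , _) =
    decidable-stable (x ≟ y) λ x≢y →
      k4 u v x y e ux uy vx vy (x-adjacent-y x≢y (path-median x (inTreePath⁻ y-inner)))
    where
    ux = proj₁ (inner-adjacent u v e x x-inner)
    vx = proj₂ (inner-adjacent u v e x x-inner)
    uy = proj₁ (inner-adjacent u v e y y-inner)
    vy = proj₂ (inner-adjacent u v e y y-inner)
    x-adjacent-y : x ≢ y → y ∈ path u x ⊎ y ∈ path x v → E G x y
    x-adjacent-y x≢y (inj₁ y∈ux) =
      proj₂ (inner-adjacent u x ux y (inTreePath⁺ y≢u (≢-sym x≢y) y∈ux))
    x-adjacent-y x≢y (inj₂ y∈xv) =
      proj₁ (inner-adjacent x v (Graph.sym G _ _ vx) y (inTreePath⁺ (≢-sym x≢y) y≢v y∈xv))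

module _ {k : ℕ} .{{_ : NonZero k}} where

  suc-% : ∀ x → suc x % k ≡ suc (x % k) % k
  suc-% x = begin
    suc x % k                     ≡⟨ cong (λ y → suc y % k) (m≡m%n+[m/n]*n x k) ⟩
    (suc (x % k) + x / k * k) % k ≡⟨ [m+kn]%n≡m%n (suc (x % k)) (x / k) k ⟩
    suc (x % k) % k               ∎

  %-congˡ-+ : ∀ {x y} o → x % k ≡ y % k → (x + o) % k ≡ (y + o) % k
  %-congˡ-+ {x} {y} o x≡y = begin
    (x + o) % k             ≡⟨ %-distribˡ-+ x o k ⟩
    (x % k + o % k) % k     ≡⟨ cong (λ z → (z + o % k) % k) x≡y ⟩
    (y % k + o % k) % k     ≡⟨ %-distribˡ-+ y o k ⟨
    (y + o) % k             ∎

  Consec⇒suc-% : {i j : Fin k} → Consec k i j → suc (toℕ i) % k ≡ toℕ j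
  Consec⇒suc-% {j = j} (inj₁ i+1≡j)         = trans (cong (_% k) i+1≡j) (m<n⇒m%n≡m (toℕ<n j))
  Consec⇒suc-% {j = j} (inj₂ (i+1≡k , j≡0)) = trans (cong (_% k) i+1≡k) (trans (n%n≡0 k) (sym j≡0))

  suc-%⇒Consec : {i j : Fin k} → suc (toℕ i) % k ≡ toℕ j → Consec k i j
  suc-%⇒Consec {i} eq with m≤n⇒m<n∨m≡n (toℕ<n i)
  ... | inj₁ i+1<k = inj₁ (trans (sym (m<n⇒m%n≡m i+1<k)) eq)
  ... | inj₂ i+1≡k = inj₂ (i+1≡k , trans (sym eq) (trans (cong (_% k) i+1≡k) (n%n≡0 k)))

+-cancelʳ-% : ∀ {k} a {i j} → (i + a) % suc k ≡ (j + a) % suc k → i % suc k ≡ j % suc k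
+-cancelʳ-% {k} a {i} {j} eq = begin
  i % suc k                 ≡⟨ [m+kn]%n≡m%n i a (suc k) ⟨
  (i + a * suc k) % suc k   ≡⟨ cong (_% suc k) (regroup i) ⟩
  (i + a + a * k) % suc k   ≡⟨ %-congˡ-+ {x = i + a} {j + a} (a * k) eq ⟩
  (j + a + a * k) % suc k   ≡⟨ cong (_% suc k) (regroup j) ⟨
  (j + a * suc k) % suc k   ≡⟨ [m+kn]%n≡m%n j a (suc k) ⟩
  j % suc k                 ∎
  where
  regroup : ∀ x → x + a * suc k ≡ x + a + a * k
  regroup x = trans (cong (x +_) (*-suc a k)) (sym (+-assoc x a (a * k)))

module Unrolling {k : ℕ} .{{_ : NonZero k}} {A : Set} (c : Fin k → A) where

  index : ℕ → Fin k
  index x = fromℕ< (m%n<n x k)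

  toℕ-index : ∀ x → toℕ (index x) ≡ x % k
  toℕ-index x = toℕ-fromℕ< (m%n<n x k)

  unroll : ℕ → A
  unroll x = c (index x)

  unroll-cong : ∀ {x y} → x % k ≡ y % k → unroll x ≡ unroll y
  unroll-cong {x} {y} eq =
    cong c (toℕ-injective (trans (toℕ-index x) (trans eq (sym (toℕ-index y)))))

  unroll-toℕ : ∀ i → unroll (toℕ i) ≡ c i
  unroll-toℕ i = cong c (toℕ-injective (trans (toℕ-index (toℕ i)) (m<n⇒m%n≡m (toℕ<n i))))

  unroll-injective : Injective _≡_ _≡_ c → ∀ {x y} → unroll x ≡ unroll y → x % k ≡ y % k
  unroll-injective c-inj {x} {y} eq =
    trans (sym (toℕ-index x)) (trans (cong toℕ (c-inj eq)) (toℕ-index y))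

  Consec-index⁻ : ∀ {x y} → Consec k (index x) (index y) → suc x % k ≡ y % k
  Consec-index⁻ {x} {y} cs = begin
    suc x % k                  ≡⟨ suc-% x ⟩
    suc (x % k) % k            ≡⟨ cong (λ z → suc z % k) (toℕ-index x) ⟨
    suc (toℕ (index x)) % k    ≡⟨ Consec⇒suc-% cs ⟩
    toℕ (index y)              ≡⟨ toℕ-index y ⟩
    y % k                      ∎

  Consec-index⁺ : ∀ {x y} → suc x % k ≡ y % k → Consec k (index x) (index y)
  Consec-index⁺ {x} {y} eq = suc-%⇒Consec (begin
    suc (toℕ (index x)) % k    ≡⟨ cong (λ z → suc z % k) (toℕ-index x) ⟩
    suc (x % k) % k            ≡⟨ suc-% x ⟨
    suc x % k                  ≡⟨ eq ⟩
    y % k                      ≡⟨ toℕ-index y ⟨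
    toℕ (index y)              ∎)

  unroll-Consec : ∀ {i j} → Consec k i j → unroll (suc (toℕ i)) ≡ c j
  unroll-Consec {i} {j} cs =
    trans (unroll-cong (trans (Consec⇒suc-% cs) (sym (m<n⇒m%n≡m (toℕ<n j))))) (unroll-toℕ j)

-- The cycle C_{4+m} read periodically along ℕ: d (t + a) is the vertex at offset t from d a, and
-- the cycle neighbours of d a are at offsets 1 and 3 + m.
record PeriodicInducedCycle {n : ℕ} (G : Graph n) (m : ℕ) (d : ℕ → Fin n) : Set where
  field
    periodic           : ∀ x → d (4 + m + x) ≡ d x
    edge               : ∀ x → E G (d x) (d (suc x))
    offset-distinct    : ∀ t a → 0 < t → t < 4 + m → d a ≢ d (t + a)
    offset-nonadjacent : ∀ t a → 1 < t → t < 3 + m → ¬ E G (d (t + a)) (d a)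

periodicInducedCycle : ∀ {n} {G : Graph n} {m} {c : Fin (4 + m) → Fin n} →
  InducedCycle G (4 + m) c → PeriodicInducedCycle G m (Unrolling.unroll c)
periodicInducedCycle {G = G} {m} {c} (c-injective , c-adjacency) = record
  { periodic           = λ x → unroll-cong {4 + m + x} {x} (%-remove-+ˡ x ∣-refl)
  ; edge               = λ x → proj₂ (c-adjacency (index x) (index (suc x)))
                                     (inj₁ (Consec-index⁺ {x} {suc x} refl))
  ; offset-distinct    = distinct
  ; offset-nonadjacent = nonadjacent
  }
  where
  open Unrolling c

  distinct : ∀ t a → 0 < t → t < 4 + m → unroll a ≢ unroll (t + a)
  distinct (suc t) a _ t<k eq =
    0≢1+n (trans (+-cancelʳ-% a {0} {suc t} (unroll-injective c-injective {a} {suc t + a} eq))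
                 (m<n⇒m%n≡m t<k))

  nonadjacent : ∀ t a → 1 < t → t < 3 + m → ¬ E G (unroll (t + a)) (unroll a)
  nonadjacent t a 1<t t<k-1 e with proj₁ (c-adjacency (index (t + a)) (index a)) e
  ... | inj₁ cs = 1+n≢0 (trans (sym (m<n⇒m%n≡m (s≤s t<k-1)))
                               (+-cancelʳ-% a {suc t} {0} (Consec-index⁻ {t + a} {a} cs)))
  ... | inj₂ cs = <⇒≢ 1<t (trans (+-cancelʳ-% a {1} {t} (Consec-index⁻ {a} {t + a} cs))
                                 (m<n⇒m%n≡m (m<n⇒m<1+n t<k-1)))

module WheelAroundInducedCycle {n : ℕ} (G T : Graph n) (connected : Connected T) (acyclic : Acyclic T)
  (inner-adjacent : InnerVerticesAdjacent G T) (k4-free : K4Free G)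
  {m : ℕ} {d : ℕ → Fin n} (cycle : PeriodicInducedCycle G m d) where

  open TreeProperties T connected acyclic
  open TreePathsOfEdges G T connected acyclic inner-adjacent
  open PeriodicInducedCycle cycle

  prev-edge : ∀ a → E G (d (3 + m + a)) (d a)
  prev-edge a = subst (E G _) (periodic a) (edge (3 + m + a))

  prev-suc : ∀ a → d (3 + m + suc a) ≡ d a
  prev-suc a = trans (cong (λ x → d (3 + x)) (+-suc m a)) (periodic a)

  prev-as-offset : ∀ a → d (2 + m + suc a) ≡ d (3 + m + a)
  prev-as-offset a = cong (λ x → d (2 + x)) (+-suc m a)

  next-distinct : ∀ a → d a ≢ d (suc a)
  next-distinct a = offset-distinct 1 a (s≤s z≤n) (s≤s (s≤s z≤n))

  prev-distinct-next : ∀ a → d (3 + m + a) ≢ d (suc a)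
  prev-distinct-next a eq = offset-distinct (2 + m) (suc a) (s≤s z≤n) (s≤s (s≤s (s≤s (n≤1+n m))))
                              (sym (trans (prev-as-offset a) eq))

  prev-nonadjacent-next : ∀ a → ¬ E G (d (3 + m + a)) (d (suc a))
  prev-nonadjacent-next a e = offset-nonadjacent (2 + m) (suc a) (s≤s (s≤s z≤n)) ≤-refl
                                (subst (λ p → E G p (d (suc a))) (sym (prev-as-offset a)) e)

  around : ∀ {a y} → d a ∉ path (d (suc a)) y → d a ∉ path (d (3 + m + a)) y
  around {a} {y} start = go (2 + m) ≤-refl
    where
    not-both : ∀ t → suc t ≤ 2 + m → ¬ (E G (d (suc t + a)) (d a) × E G (d (2 + t + a)) (d a))
    not-both zero    _  (_ , e) = offset-nonadjacent 2 a (s≤s (s≤s z≤n)) (s≤s (s≤s (s≤s z≤n))) e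
    not-both (suc t) le (e , _) = offset-nonadjacent (2 + t) a (s≤s (s≤s z≤n)) (s≤s le) e

    go : ∀ t → t ≤ 2 + m → d a ∉ path (d (suc t + a)) y
    go zero    _  = start
    go (suc t) le = path-avoid-step (go t (≤-trans (n≤1+n t) le)) (edge (suc t + a))
      (offset-distinct (suc t) a (s≤s z≤n) (s≤s (m≤n⇒m≤1+n le)))
      (offset-distinct (2 + t) a (s≤s z≤n) (s≤s (s≤s le)))
      (not-both t le)

  not-tree-edge : ∀ a → ¬ E T (d a) (d (suc a))
  not-tree-edge a eT =
    prev-nonadjacent-next a (proj₁ (inner-adjacent _ _ (prev-edge a) _ next-inside))
    where
    a∉next : d a ∉ path (d (suc a)) (d (suc a))
    a∉next a∈ with subst (d a ∈_) (path-refl _) a∈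
    ... | here eq = next-distinct a eq

    next-inside : InTreePath T (d (3 + m + a)) (d a) (d (suc a))
    next-inside = inTreePath⁺ (≢-sym (prev-distinct-next a)) (≢-sym (next-distinct a))
                    (path-snoc (Graph.sym T _ _ eT) (around a∉next))

  hub : ℕ → Fin n
  hub a = proj₁ (path-successor (next-distinct a))

  hub-inner : ∀ a → InTreePath T (d a) (d (suc a)) (hub a) × InTreePath T (d (3 + m + a)) (d a) (hub a)
  hub-inner a = next-inner , prev-inner
    where
    w = hub a
    tree-edge : E T (d a) w
    tree-edge = proj₁ (proj₂ (path-successor (next-distinct a)))
    split : path (d a) (d (suc a)) ≡ d a ∷ path w (d (suc a))
    split = proj₂ (proj₂ (path-successor (next-distinct a)))

    w≢a : w ≢ d a
    w≢a w≡a = Graph.irrefl T (d a) (subst (E T (d a)) w≡a tree-edge)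

    next-inner : InTreePath T (d a) (d (suc a)) w
    next-inner = inTreePath⁺ w≢a (λ w≡v → not-tree-edge a (subst (E T (d a)) w≡v tree-edge))
                   (subst (w ∈_) (sym split) (there (head∈path w (d (suc a)))))

    w≢prev : w ≢ d (3 + m + a)
    w≢prev w≡p = prev-nonadjacent-next a (Graph.sym G _ _
      (subst (E G (d (suc a))) w≡p (proj₂ (inner-adjacent _ _ (edge a) w next-inner))))

    a∉next-w : d a ∉ path (d (suc a)) w
    a∉next-w = Unique[x∷xs]⇒x∉xs (subst Unique split (pathWalk-isPath _ _)) ∘ path-sym

    prev-inner : InTreePath T (d (3 + m + a)) (d a) w
    prev-inner = inTreePath⁺ w≢prev w≢a (path-snoc (Graph.sym T _ _ tree-edge) (around a∉next-w))

  hub-suc : ∀ a → hub (suc a) ≡ hub a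
  hub-suc a = inTreePath-unique k4-free (edge a)
    (subst (λ p → InTreePath T p (d (suc a)) (hub (suc a))) (prev-suc a) (proj₂ (hub-inner (suc a))))
    (proj₁ (hub-inner a))

  hub-constant : ∀ a → hub a ≡ hub 0
  hub-constant zero    = refl
  hub-constant (suc a) = trans (hub-suc a) (hub-constant a)

  hub-adjacent : ∀ a → E G (d a) (hub 0)
  hub-adjacent a =
    subst (E G (d a)) (hub-constant a) (proj₁ (inner-adjacent _ _ (edge a) _ (proj₁ (hub-inner a))))

lemma3 : ∀ {n} (G T : Graph n) → Connected G → DuallyChordal G → K4Free G →
    SpanningTree G T →
    (∀ u v → E G u v → ∀ w → InTreePath T u v w → E G u w × E G v w) →
    (k : ℕ) → 4 ≤ k → (c : Fin k → Fin n) → InducedCycle G k c →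
    (∃[ w ] ((∀ i → w ≢ c i) × (∀ i → E G w (c i)))) ×
    (∀ i j → CycAdj k i j → ¬ E T (c i) (c j))
lemma3 G T _ _ k4-free (_ , connected , acyclic) inner-adjacent _
       (s≤s (s≤s (s≤s (s≤s (z≤n {m}))))) c ic =
  (hub 0 , (λ i hub≡c → Graph.irrefl G _ (subst (E G _) (sym hub≡c) (c-adjacent i))) , c-adjacent) ,
  no-tree-edge
  where
  open Unrolling c
  open WheelAroundInducedCycle G T connected acyclic inner-adjacent k4-free (periodicInducedCycle ic)

  c-adjacent : ∀ i → E G (hub 0) (c i)
  c-adjacent i = Graph.sym G _ _ (subst (λ v → E G v (hub 0)) (unroll-toℕ i) (hub-adjacent (toℕ i)))

  no-tree-edge : ∀ i j → CycAdj (4 + m) i j → ¬ E T (c i) (c j)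
  no-tree-edge i j (inj₁ cs) eT =
    not-tree-edge (toℕ i) (subst₂ (E T) (sym (unroll-toℕ i)) (sym (unroll-Consec cs)) eT)
  no-tree-edge i j (inj₂ cs) eT = no-tree-edge j i (inj₁ cs) (Graph.sym T _ _ eT)
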